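{- Let $G$ be a graph and $H=\mathcal{I}(G)$. Let $X,Y,Z$ be $i$-sets of $G$ with $X\neq Z$, such that $Y=(X-\{x\})\cup\{y_1\}$ for some $x\in X$ and $y_1\notin X$ with $xy_1\in E(G)$, and $Z=(Y-\{y_2\})\cup\{z\}$ for some $y_2\in Y$ and $z\notin Y$ with $y_2z\in E(G)$. Then $XZ\in E(H)$ if and only if $y_1=y_2$.
   Context: All graphs are finite and simple. For a graph $G$, $i(G)$ denotes the minimum cardinality of an independent dominating set of $G$; an independent dominating set of cardinality $i(G)$ is an $i$-set of $G$. The $i$-graph $\mathcal{I}(G)$ of $G$ is the graph whose vertices are the $i$-sets of $G$, where two $i$-sets $S$ and $S'$ are adjacent if and only if there is an edge $xy\in E(G)$ with $S'=(S-\{x\})\cup\{y\}$. -}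

module Defs where

open import Data.Nat using (ℕ; _≤_)
open import Data.Fin using (Fin)
open import Data.Fin.Subset using (Subset; _∈_; _∪_; _-_; ⁅_⁆; ∣_∣)
open import Data.Product using (_×_; ∃; ∃-syntax)
open import Data.Sum using (_⊎_)
open import Relation.Nullary using (¬_)
open import Relation.Binary.PropositionalEquality using (_≡_)

record Graph (n : ℕ) : Set₁ where
  field
    Adj    : Fin n → Fin n → Set
    sym    : ∀ {u v} → Adj u v → Adj v u
    irrefl : ∀ {u} → ¬ Adj u u
open Graph public

module _ {n : ℕ} (G : Graph n) where

  Independent : Subset n → Set
  Independent S = ∀ u v → u ∈ S → v ∈ S → ¬ Adj G u v

  Dominating : Subset n → Set
  Dominating S = ∀ v → v ∈ S ⊎ (∃[ u ] (u ∈ S × Adj G u v))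

  IndependentDominating : Subset n → Set
  IndependentDominating S = Independent S × Dominating S

  ISet : Subset n → Set
  ISet S = IndependentDominating S
         × (∀ T → IndependentDominating T → ∣ S ∣ ≤ ∣ T ∣)

  swap : Subset n → Fin n → Fin n → Subset n
  swap S x y = (S - x) ∪ ⁅ y ⁆

  IGraphEdge : Subset n → Subset n → Set
  IGraphEdge S S' = ISet S × ISet S'
                  × ∃[ x ] ∃[ y ] (Adj G x y × S' ≡ swap S x y)

{-# OPTIONS --safe #-}
-- If the second swap
-- removes the vertex y₁ that the first one added, the two swaps compose to
-- the single swap X ↦ (X - x) ∪ {z}; domination of Z forces x ~ z, so XZ is
-- an edge.  Otherwise y₁ survives in Z, and any single swap producing Z from
-- X must add y₁ and remove x, so the adjacent vertices x and y₁ both lie in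
-- the independent set Z.
module Submission where

open import Defs hiding (sym)
open import Data.Nat using (ℕ)
open import Data.Fin using (Fin; _≟_)
open import Data.Fin.Subset using (Subset; _∈_; _∉_; _─_; _-_; _∪_; ⁅_⁆; _⊆_; inside; outside)
open import Data.Fin.Subset.Properties
  using (x∈p∪q⁻; x∈p∪q⁺; p─q⊆p; x∈p∧x≢y⇒x∈p-y; x∈⁅x⁆; x∈⁅y⁆⇒x≡y; ⊆-antisym)
open import Data.Vec using (_∷_; here; there)
open import Data.Product using (_×_; _,_; proj₁; proj₂)
open import Data.Sum using (_⊎_; inj₁; inj₂)
open import Relation.Nullary using (yes; no; contradiction)
open import Function.Bundles using (_⇔_; mk⇔)
open import Relation.Binary.PropositionalEquality
  using (_≡_; _≢_; refl; sym; trans; subst)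

private
  variable
    n : ℕ
    S : Subset n
    a b v : Fin n

x∈p─q⇒x∉q : ∀ (p q : Subset n) → v ∈ p ─ q → v ∉ q
x∈p─q⇒x∉q (inside  ∷ p) (outside ∷ q) here      ()
x∈p─q⇒x∉q (_       ∷ p) (_       ∷ q) (there m) (there m') = x∈p─q⇒x∉q p q m m'

x∈p-y⇒x≢y : ∀ (p : Subset n) → v ∈ p - a → v ≢ a
x∈p-y⇒x≢y {a = a} p m refl = x∈p─q⇒x∉q p ⁅ a ⁆ m (x∈⁅x⁆ a)

∈-swap⁻ : ∀ (S : Subset n) a b → v ∈ (S - a) ∪ ⁅ b ⁆ → (v ∈ S × v ≢ a) ⊎ v ≡ b
∈-swap⁻ S a b m with x∈p∪q⁻ (S - a) ⁅ b ⁆ m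
... | inj₁ m∈S-a = inj₁ (p─q⊆p S ⁅ a ⁆ m∈S-a , x∈p-y⇒x≢y S m∈S-a)
... | inj₂ m∈⁅b⁆ = inj₂ (x∈⁅y⁆⇒x≡y b m∈⁅b⁆)

∈-swap⁺ : ∀ b → v ∈ S → v ≢ a → v ∈ (S - a) ∪ ⁅ b ⁆
∈-swap⁺ b v∈S v≢a = x∈p∪q⁺ (inj₁ (x∈p∧x≢y⇒x∈p-y v∈S v≢a))

∈-swap-added : ∀ (S : Subset n) a b → b ∈ (S - a) ∪ ⁅ b ⁆
∈-swap-added S a b = x∈p∪q⁺ (inj₂ (x∈⁅x⁆ b))

∈-swap∧∉⇒≡ : ∀ (S : Subset n) a b → v ∈ (S - a) ∪ ⁅ b ⁆ → v ∉ S → v ≡ b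
∈-swap∧∉⇒≡ S a b m v∉S with ∈-swap⁻ S a b m
... | inj₁ (v∈S , _) = contradiction v∈S v∉S
... | inj₂ v≡b       = v≡b

∈∧∉-swap⇒≡ : ∀ b → v ∈ S → v ∉ (S - a) ∪ ⁅ b ⁆ → v ≡ a
∈∧∉-swap⇒≡ {v = v} {a = a} b v∈S v∉swap with v ≟ a
... | yes v≡a = v≡a
... | no  v≢a = contradiction (∈-swap⁺ b v∈S v≢a) v∉swap

∉-swap-removed : ∀ (S : Subset n) → a ≢ b → a ∉ (S - a) ∪ ⁅ b ⁆
∉-swap-removed {a = a} {b = b} S a≢b m with ∈-swap⁻ S a b m
... | inj₁ (_ , a≢a) = a≢a refl
... | inj₂ a≡b       = a≢b a≡b

swap-self : ∀ (S : Subset n) → a ∈ S → (S - a) ∪ ⁅ a ⁆ ≡ S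
swap-self {a = a} S a∈S = ⊆-antisym ⊆S S⊆
  where
  ⊆S : (S - a) ∪ ⁅ a ⁆ ⊆ S
  ⊆S m with ∈-swap⁻ S a a m
  ... | inj₁ (v∈S , _) = v∈S
  ... | inj₂ refl      = a∈S

  S⊆ : S ⊆ (S - a) ∪ ⁅ a ⁆
  S⊆ {v} v∈S with v ≟ a
  ... | yes refl = ∈-swap-added S a a
  ... | no  v≢a  = ∈-swap⁺ a v∈S v≢a

swap-swap : ∀ (S : Subset n) a b c → b ∉ S
          → (((S - a) ∪ ⁅ b ⁆) - b) ∪ ⁅ c ⁆ ≡ (S - a) ∪ ⁅ c ⁆
swap-swap S a b c b∉S = ⊆-antisym ⊆direct direct⊆
  where
  ⊆direct : (((S - a) ∪ ⁅ b ⁆) - b) ∪ ⁅ c ⁆ ⊆ (S - a) ∪ ⁅ c ⁆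
  ⊆direct m with ∈-swap⁻ ((S - a) ∪ ⁅ b ⁆) b c m
  ... | inj₂ refl = ∈-swap-added S a c
  ... | inj₁ (m′ , v≢b) with ∈-swap⁻ S a b m′
  ...   | inj₁ (v∈S , v≢a) = ∈-swap⁺ c v∈S v≢a
  ...   | inj₂ v≡b         = contradiction v≡b v≢b

  direct⊆ : (S - a) ∪ ⁅ c ⁆ ⊆ (((S - a) ∪ ⁅ b ⁆) - b) ∪ ⁅ c ⁆
  direct⊆ m with ∈-swap⁻ S a c m
  ... | inj₂ refl = ∈-swap-added _ b c
  ... | inj₁ (v∈S , v≢a) =
    ∈-swap⁺ c (∈-swap⁺ b v∈S v≢a) (λ { refl → b∉S v∈S })

module _ (G : Graph n) where

  swap-dominating⇒Adj : Independent G S → Dominating G (swap G S a b)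
                      → a ∈ S → a ≢ b → Adj G a b
  swap-dominating⇒Adj {S = S} {a = a} {b = b} S-indep dom a∈S a≢b with dom a
  ... | inj₁ a∈swap = contradiction a∈swap (∉-swap-removed S a≢b)
  ... | inj₂ (u , u∈swap , u~a) with ∈-swap⁻ S a b u∈swap
  ...   | inj₁ (u∈S , _) = contradiction u~a (S-indep u a u∈S a∈S)
  ...   | inj₂ refl      = Graph.sym G u~a

  swap-swap≡swap⇒≡ : ∀ {X : Subset n} {x y₁ y₂ z : Fin n}
    → Adj G x y₁ → y₁ ∉ X → z ∉ swap G X x y₁
    → Independent G (swap G (swap G X x y₁) y₂ z)
    → swap G (swap G X x y₁) y₂ z ≡ swap G X a b
    → y₁ ≡ y₂
  swap-swap≡swap⇒≡ {a = a} {b = b} {X = X} {x} {y₁} {y₂} {z} x~y₁ y₁∉X z∉Y Z-indep Z≡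
    with y₁ ≟ y₂
  ... | yes y₁≡y₂ = y₁≡y₂
  ... | no  y₁≢y₂ = contradiction x~y₁ (Z-indep x y₁ x∈Z y₁∈Z)
    where
    Y Z : Subset n
    Y = swap G X x y₁
    Z = swap G Y y₂ z

    y₁∈Z : y₁ ∈ Z
    y₁∈Z = ∈-swap⁺ z (∈-swap-added X x y₁) y₁≢y₂

    y₁≡b : y₁ ≡ b
    y₁≡b = ∈-swap∧∉⇒≡ X a b (subst (y₁ ∈_) Z≡ y₁∈Z) y₁∉X

    z∈X : z ∈ X
    z∈X with ∈-swap⁻ X a b (subst (z ∈_) Z≡ (∈-swap-added Y y₂ z))
    ... | inj₁ (z∈X , _) = z∈X
    ... | inj₂ z≡b       =
      contradiction (subst (_∈ Y) (trans y₁≡b (sym z≡b)) (∈-swap-added X x y₁)) z∉Y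

    x∈Z : x ∈ Z
    x∈Z = subst (_∈ Z) (∈∧∉-swap⇒≡ y₁ z∈X z∉Y) (∈-swap-added Y y₂ z)

lemma2p3 : (n : ℕ) (G : Graph n) (X Y Z : Subset n)
    → ISet G X → ISet G Y → ISet G Z → X ≢ Z
    → (x y₁ y₂ z : Fin n)
    → x ∈ X → y₁ ∉ X → Adj G x y₁ → Y ≡ swap G X x y₁
    → y₂ ∈ Y → z ∉ Y → Adj G y₂ z → Z ≡ swap G Y y₂ z
    → (IGraphEdge G X Z ⇔ y₁ ≡ y₂)
lemma2p3 n G X _ _ iX _ iZ X≢Z x y₁ y₂ z x∈X y₁∉X x~y₁ refl _ z∉Y _ refl =
  mk⇔ edge⇒y₁≡y₂ y₁≡y₂⇒edge
  where
  Z : Subset n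
  Z = swap G (swap G X x y₁) y₂ z

  edge⇒y₁≡y₂ : IGraphEdge G X Z → y₁ ≡ y₂
  edge⇒y₁≡y₂ (_ , _ , _ , _ , _ , Z≡) =
    swap-swap≡swap⇒≡ G x~y₁ y₁∉X z∉Y (proj₁ (proj₁ iZ)) Z≡

  y₁≡y₂⇒edge : y₁ ≡ y₂ → IGraphEdge G X Z
  y₁≡y₂⇒edge refl = iX , iZ , x , z , x~z , Z≡
    where
    Z≡ : Z ≡ swap G X x z
    Z≡ = swap-swap X x y₁ z y₁∉X
    x≢z : x ≢ z
    x≢z refl = X≢Z (sym (trans Z≡ (swap-self X x∈X)))
    x~z : Adj G x z
    x~z = swap-dominating⇒Adj G (proj₁ (proj₁ iX))
            (subst (Dominating G) Z≡ (proj₂ (proj₁ iZ))) x∈X x≢z
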